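{- Let $\Phi$ be a definition, $P$ a defined predicate of $\Phi$, and $\bar y$ a tuple of object symbols of length the arity of $P$ not occurring freely in the body of any definitional rule of $\Phi$ whose head has predicate $P$. Let $(\mathcal I,\mathcal H)$ be a Henkin structure such that $(\mathcal I,\mathcal H)\models_H\Phi$. Then $\mathcal I\models\forall\bar y:P(\bar y)\Leftrightarrow\varphi_P(\bar y)$.
   Context: A definitional rule is $\forall\bar x:P(\bar t)\leftarrow\varphi$ ($P$ a predicate symbol, $\bar t$ terms, $\varphi$ a first-order formula, the body); a definition $\Phi$ is a finite set of rules such that for each rule no object symbol of its $\bar x$ occurs freely in another rule. Object symbols are $0$-ary function symbols. $\mathrm{Def}(\Phi)$: head predicates; $\mathrm{Par}(\Phi)$: other non-logical symbols of $\Phi$; $\mathrm{Sym}(\Phi)$: union. An occurrence is positive/negative if within an even/odd number of negations after rewriting $\Rightarrow,\Leftrightarrow$. The merged body $\varphi_P(\bar y)$ is the disjunction of $\exists\bar x:(\bar y=\bar t\wedge\varphi)$ over all rules $\forall\bar x:P(\bar t)\leftarrow\varphi$ of $\Phi$. A Henkin class for a structure $\mathcal I$ with domain $D$ is a family $\{H_k\}_{k\in\mathbb N}$, $H_k\subseteq\mathcal P(D^k)$, such that: (i) the diagonal of $D^2$ is in $H_2$; (ii) $Q^{\mathcal I}\in H_{\mathrm{ar}(Q)}$ for each predicate $Q$ of $\mathcal I$; (iii) if $R\in H_{k+1}$, $a\in D$ then $\{\bar a\mid(\bar a,a)\in R\}\in H_k$; (iv) if $R\in H_k$, $t_1,\dots,t_k$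 terms, $\bar x=(x_1,\dots,x_n),\bar y$ distinct object symbols, $\bar b\in D^{|\bar y|}$ then $\{\bar a\in D^n\mid\bar t^{\mathcal I[\bar x:\bar a,\bar y:\bar b]}\in R\}\in H_n$; (v) complements in $D^k$; (vi) intersections; (vii) if $R\in H_{k+1}$ then $\{\bar a\mid(\bar a,a)\in R\ \forall a\in D\}\in H_k$. A Henkin structure is a pair $(\mathcal I,\mathcal H)$ with $\mathcal H$ a Henkin class for $\mathcal I$. For a definition $\Phi$ and a structure $\mathcal O$ with vocabulary $\mathrm{Par}(\Phi)$: $\mathcal S$ is the set of $\mathrm{Sym}(\Phi)$-structures expanding $\mathcal O$; $\mathcal I\sqsubseteq\mathcal J$ iff $P^{\mathcal I}\subseteq P^{\mathcal J}$ for $P\in\mathrm{Def}(\Phi)$; $\mathcal C(\mathcal I,\mathcal J)\in\mathcal S$ interprets $P\in\mathrm{Def}(\Phi)$ as the set of $\bar a$ for which $\varphi_P(\bar y)$ holds at $\bar y:=\bar a$ when positive occurrences of defined predicates are read in $\mathcal I$ and negative ones in $\mathcal J$; $\mathcal J$ is an $\mathcal H$-point if $P^{\mathcal J}\in H_{\mathrm{ar}(P)}$ for $P\in\mathrm{Def}(\Phi)$; $(\mathcal I,\mathcal H)$ is a Henkin model of $\Phi$ in $\mathcal O$ if $\mathcal I$ is the least pre-fixed $\mathcal H$-point of $\mathcal C(\cdot,\mathcal I)$, i.e. $\mathcal I$ is an $\mathcal H$-point, $\mathcal C(\mathcal I,\mathcal I)\sqsubseteq\mathcal I$, and $\mathcal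 I\sqsubseteq\mathcal J$ for every $\mathcal H$-point $\mathcal J$ with $\mathcal C(\mathcal J,\mathcal I)\sqsubseteq\mathcal J$. $(\mathcal I,\mathcal H)\models_H\Phi$ iff $(\mathcal I|_{\mathrm{Sym}(\Phi)},\mathcal H)$ is a Henkin model of $\Phi$ in $\mathcal I|_{\mathrm{Par}(\Phi)}$.
   Formalization: ȳ must also avoid the head terms t̄ and the quantified symbols x̄ of every definitional rule whose head has predicate P, not only its body. Each condition added here is assumed in the paper as well or is needed for the statement above to hold. -}

module Defs where

open import Level using (0ℓ) renaming (suc to lsuc)
open import Data.Nat using (ℕ; zero; suc; _⊔_)
open import Data.Nat.Properties using (_≟_)
open import Data.Bool using (Bool; true; false)
open import Data.Product using (Σ; ∃; _×_; _,_; proj₁; proj₂)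
open import Data.Product.Properties using (≡-dec)
open import Data.Sum using (_⊎_)
open import Data.Unit using (⊤)
open import Data.Empty using (⊥)
open import Data.Fin using (Fin)
open import Data.List as List using (List; []; _∷_; concatMap; lookup; length)
import Data.List.Relation.Unary.Any as LAny
open import Data.List.Relation.Unary.Any.Properties using ()
import Data.List.Membership.Propositional as LMem
open import Data.Vec as Vec using (Vec; []; _∷_; _∷ʳ_; _++_)
import Data.Vec.Relation.Unary.Any as VAny
import Data.Vec.Membership.Propositional as VMem
open import Data.Vec.Relation.Unary.Unique.Propositional using (Unique)
open import Relation.Nullary using (¬_; Dec; yes; no)
open import Relation.Binary.PropositionalEquality using (_≡_; _≢_; refl)
open import Relation.Binary.Definitions using (DecidableEquality)
open import Function.Bundles using (_⇔_)

-- A symbol is a pair (name , arity).  Object symbols are the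
-- 0-ary function symbols (x , 0); they also serve as the variables
-- bound by quantifiers (the paper quantifies over object symbols).

FSym : Set
FSym = ℕ × ℕ

PSym : Set
PSym = ℕ × ℕ

ar : ℕ × ℕ → ℕ
ar = proj₂

_≟S_ : DecidableEquality (ℕ × ℕ)
_≟S_ = ≡-dec _≟_ _≟_

obj : ℕ → FSym
obj x = (x , 0)

data Term : Set where
  app : (f : FSym) → Vec Term (ar f) → Term

var : ℕ → Term
var x = app (obj x) []

infixr 6 _∧'_
infixr 5 _∨'_
infixr 4 _⇒'_ _⇔'_
infix 7 _≐'_

data Formula : Set where
  ⊤' ⊥'         : Formula
  atom          : (p : PSym) → Vec Term (ar p) → Formula
  _≐'_          : Term → Term → Formula
  ¬'_           : Formula → Formula
  _∧'_ _∨'_     : Formula → Formula → Formula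
  _⇒'_ _⇔'_     : Formula → Formula → Formula
  ∀' ∃'         : ℕ → Formula → Formula

∀* : ∀ {n} → Vec ℕ n → Formula → Formula
∀* [] φ = φ
∀* (x ∷ xs) φ = ∀' x (∀* xs φ)

∃* : List ℕ → Formula → Formula
∃* [] φ = φ
∃* (x ∷ xs) φ = ∃' x (∃* xs φ)

⋀ : List Formula → Formula
⋀ [] = ⊤'
⋀ (φ ∷ []) = φ
⋀ (φ ∷ ψ ∷ φs) = φ ∧' ⋀ (ψ ∷ φs)

⋁ : List Formula → Formula
⋁ [] = ⊥'
⋁ (φ ∷ []) = φ
⋁ (φ ∷ ψ ∷ φs) = φ ∨' ⋁ (ψ ∷ φs)

data _∈T_ (f : FSym) : Term → Set where
  here  : ∀ {ts} → f ∈T app f ts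
  under : ∀ {g ts} → VAny.Any (f ∈T_) ts → f ∈T app g ts

data FreeIn (f : FSym) : Formula → Set where
  atom  : ∀ {p ts} → VAny.Any (f ∈T_) ts → FreeIn f (atom p ts)
  eqˡ   : ∀ {t u} → f ∈T t → FreeIn f (t ≐' u)
  eqʳ   : ∀ {t u} → f ∈T u → FreeIn f (t ≐' u)
  neg   : ∀ {φ} → FreeIn f φ → FreeIn f (¬' φ)
  andˡ  : ∀ {φ ψ} → FreeIn f φ → FreeIn f (φ ∧' ψ)
  andʳ  : ∀ {φ ψ} → FreeIn f ψ → FreeIn f (φ ∧' ψ)
  orˡ   : ∀ {φ ψ} → FreeIn f φ → FreeIn f (φ ∨' ψ)
  orʳ   : ∀ {φ ψ} → FreeIn f ψ → FreeIn f (φ ∨' ψ)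
  impˡ  : ∀ {φ ψ} → FreeIn f φ → FreeIn f (φ ⇒' ψ)
  impʳ  : ∀ {φ ψ} → FreeIn f ψ → FreeIn f (φ ⇒' ψ)
  iffˡ  : ∀ {φ ψ} → FreeIn f φ → FreeIn f (φ ⇔' ψ)
  iffʳ  : ∀ {φ ψ} → FreeIn f ψ → FreeIn f (φ ⇔' ψ)
  all   : ∀ {x φ} → f ≢ obj x → FreeIn f φ → FreeIn f (∀' x φ)
  ex    : ∀ {x φ} → f ≢ obj x → FreeIn f φ → FreeIn f (∃' x φ)

data PredIn (p : PSym) : Formula → Set where
  atom  : ∀ {ts} → PredIn p (atom p ts)
  neg   : ∀ {φ} → PredIn p φ → PredIn p (¬' φ)
  andˡ  : ∀ {φ ψ} → PredIn p φ → PredIn p (φ ∧' ψ)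
  andʳ  : ∀ {φ ψ} → PredIn p ψ → PredIn p (φ ∧' ψ)
  orˡ   : ∀ {φ ψ} → PredIn p φ → PredIn p (φ ∨' ψ)
  orʳ   : ∀ {φ ψ} → PredIn p ψ → PredIn p (φ ∨' ψ)
  impˡ  : ∀ {φ ψ} → PredIn p φ → PredIn p (φ ⇒' ψ)
  impʳ  : ∀ {φ ψ} → PredIn p ψ → PredIn p (φ ⇒' ψ)
  iffˡ  : ∀ {φ ψ} → PredIn p φ → PredIn p (φ ⇔' ψ)
  iffʳ  : ∀ {φ ψ} → PredIn p ψ → PredIn p (φ ⇔' ψ)
  all   : ∀ {x φ} → PredIn p φ → PredIn p (∀' x φ)
  ex    : ∀ {x φ} → PredIn p φ → PredIn p (∃' x φ)

-- Definitions (sets of definitional rules  ∀ x̄ : P(t̄) ← φ )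

record Rule : Set where
  constructor rule
  field
    vars : List ℕ
    head : PSym
    args : Vec Term (ar head)
    body : Formula
open Rule public

FreeInRule : FSym → Rule → Set
FreeInRule f r =
  (VAny.Any (f ∈T_) (args r) ⊎ FreeIn f (body r)) × (∀ x → x LMem.∈ vars r → f ≢ obj x)

IsDefinition : List Rule → Set
IsDefinition Φ = (i j : Fin (length Φ)) → i ≢ j →
  ∀ x → x LMem.∈ vars (lookup Φ i) → ¬ FreeInRule (obj x) (lookup Φ j)

Defined : List Rule → PSym → Set
Defined Φ p = LAny.Any (λ r → head r ≡ p) Φ

defined? : (Φ : List Rule) (p : PSym) → Dec (Defined Φ p)
defined? Φ p = LAny.any? (λ r → head r ≟S p) Φ

record Vocab : Set₁ where
  field
    fs : FSym → Set
    ps : PSym → Set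
open Vocab public

SymV : List Rule → Vocab
fs (SymV Φ) f = LAny.Any (FreeInRule f) Φ
ps (SymV Φ) p = Defined Φ p ⊎ LAny.Any (λ r → PredIn p (body r)) Φ

_⊆V_ : Vocab → Vocab → Set
V ⊆V W = (∀ f → fs V f → fs W f) × (∀ p → ps V p → ps W p)

-- merged body  φ_P(ȳ) = ⋁ { ∃ x̄ : (ȳ = t̄ ∧ φ) | ∀ x̄ : P(t̄) ← φ ∈ Φ }
eqs : ∀ {n} → Vec ℕ n → Vec Term n → List Formula
eqs [] [] = []
eqs (y ∷ ys) (t ∷ ts) = (var y ≐' t) ∷ eqs ys ts

ruleDisjunct : (P : PSym) → Vec ℕ (ar P) → Rule → List Formula
ruleDisjunct P ys r with head r ≟S P
... | yes refl = ∃* (vars r) (⋀ (eqs ys (args r)) ∧' body r) ∷ []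
... | no _ = []

mergedBody : List Rule → (P : PSym) → Vec ℕ (ar P) → Formula
mergedBody Φ P ys = ⋁ (concatMap (ruleDisjunct P ys) Φ)

-- a canonical tuple of fresh object symbols (names larger than every
-- name occurring in Φ), used to define the operator C
mutual
  maxT : Term → ℕ
  maxT (app f ts) = proj₁ f ⊔ maxTs ts

  maxTs : ∀ {n} → Vec Term n → ℕ
  maxTs [] = 0
  maxTs (t ∷ ts) = maxT t ⊔ maxTs ts

maxF : Formula → ℕ
maxF ⊤' = 0
maxF ⊥' = 0
maxF (atom p ts) = maxTs ts
maxF (t ≐' u) = maxT t ⊔ maxT u
maxF (¬' φ) = maxF φ
maxF (φ ∧' ψ) = maxF φ ⊔ maxF ψ
maxF (φ ∨' ψ) = maxF φ ⊔ maxF ψ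
maxF (φ ⇒' ψ) = maxF φ ⊔ maxF ψ
maxF (φ ⇔' ψ) = maxF φ ⊔ maxF ψ
maxF (∀' x φ) = x ⊔ maxF φ
maxF (∃' x φ) = x ⊔ maxF φ

maxR : Rule → ℕ
maxR r = List.foldr _⊔_ 0 (vars r) ⊔ maxTs (args r) ⊔ maxF (body r)

maxΦ : List Rule → ℕ
maxΦ Φ = List.foldr (λ r m → maxR r ⊔ m) 0 Φ

freshVec : ℕ → (k : ℕ) → Vec ℕ k
freshVec m zero = []
freshVec m (suc k) = m ∷ freshVec (suc m) k

freshYs : List Rule → (k : ℕ) → Vec ℕ k
freshYs Φ k = freshVec (suc (maxΦ Φ)) k

-- Semantics.  Structures interpret every symbol; the vocabulary of a
-- structure is tracked separately (a Vocab) where it matters.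

Funs : Set → Set
Funs D = (f : FSym) → Vec D (ar f) → D

Rels : Set → Set₁
Rels D = (p : PSym) → Vec D (ar p) → Set

record Structure : Set₁ where
  field
    D   : Set
    fun : Funs D
    rel : Rels D
open Structure public

mutual
  evalT : ∀ {D} → Funs D → Term → D
  evalT F (app f ts) = F f (evalTs F ts)

  evalTs : ∀ {D n} → Funs D → Vec Term n → Vec D n
  evalTs F [] = []
  evalTs F (t ∷ ts) = evalT F t ∷ evalTs F ts

_[_↦_] : ∀ {D} → Funs D → ℕ → D → Funs D
(F [ x ↦ a ]) f with f ≟S obj x
... | yes refl = λ _ → a
... | no _ = F f

_[_↦*_] : ∀ {D n} → Funs D → Vec ℕ n → Vec D n → Funs D
F [ [] ↦* [] ] = F
F [ x ∷ xs ↦* a ∷ as ] = (F [ x ↦ a ]) [ xs ↦* as ]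

Sat : ∀ {D} → Funs D → Rels D → Formula → Set
Sat F R ⊤' = ⊤
Sat F R ⊥' = ⊥
Sat F R (atom p ts) = R p (evalTs F ts)
Sat F R (t ≐' u) = evalT F t ≡ evalT F u
Sat F R (¬' φ) = ¬ Sat F R φ
Sat F R (φ ∧' ψ) = Sat F R φ × Sat F R ψ
Sat F R (φ ∨' ψ) = Sat F R φ ⊎ Sat F R ψ
Sat F R (φ ⇒' ψ) = Sat F R φ → Sat F R ψ
Sat F R (φ ⇔' ψ) = (Sat F R φ → Sat F R ψ) × (Sat F R ψ → Sat F R φ)
Sat F R (∀' x φ) = ∀ a → Sat (F [ x ↦ a ]) R φ
Sat F R (∃' x φ) = Σ _ λ a → Sat (F [ x ↦ a ]) R φ

_⊨_ : Structure → Formula → Set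
I ⊨ φ = Sat (fun I) (rel I) φ

-- satisfaction where predicate atoms in positive positions are read in
-- I and those in negative positions in J (after rewriting ⇒ and ⇔:
-- φ ⇒ ψ = ¬φ ∨ ψ,  φ ⇔ ψ = (¬φ ∨ ψ) ∧ (¬ψ ∨ φ))
SatC : ∀ {D} → Funs D → (I J : Rels D) → Formula → Set
SatC F I J ⊤' = ⊤
SatC F I J ⊥' = ⊥
SatC F I J (atom p ts) = I p (evalTs F ts)
SatC F I J (t ≐' u) = evalT F t ≡ evalT F u
SatC F I J (¬' φ) = ¬ SatC F J I φ
SatC F I J (φ ∧' ψ) = SatC F I J φ × SatC F I J ψ
SatC F I J (φ ∨' ψ) = SatC F I J φ ⊎ SatC F I J ψ
SatC F I J (φ ⇒' ψ) = ¬ SatC F J I φ ⊎ SatC F I J ψ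
SatC F I J (φ ⇔' ψ) = (¬ SatC F J I φ ⊎ SatC F I J ψ) × (¬ SatC F J I ψ ⊎ SatC F I J φ)
SatC F I J (∀' x φ) = ∀ a → SatC (F [ x ↦ a ]) I J φ
SatC F I J (∃' x φ) = Σ _ λ a → SatC (F [ x ↦ a ]) I J φ

-- H k R  means  R ∈ H_k  (R ⊆ D^k given as a predicate on Vec D k)
HClass : Set → Set₂
HClass D = (k : ℕ) → (Vec D k → Set) → Set₁

diagonal : ∀ {D} → Vec D 2 → Set
diagonal (a ∷ b ∷ []) = a ≡ b

record IsHenkinClass (V : Vocab) (I : Structure) (H : HClass (D I)) : Set₁ where
  field
    -- H_k consists of subsets of D^k: membership is extensional
    extensional : ∀ {k} {R S : Vec (D I) k → Set} → H k R →
                  (∀ as → R as ⇔ S as) → H k S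
    diag        : H 2 diagonal
    preds       : ∀ Q → ps V Q → H (ar Q) (rel I Q)
    section     : ∀ {k} {R} → H (suc k) R → ∀ a → H k (λ as → R (as ∷ʳ a))
    substitute  : ∀ {k} {R} → H k R → (ts : Vec Term k) →
                  ∀ {n m} (xs : Vec ℕ n) (ys : Vec ℕ m) → Unique (xs ++ ys) →
                  (∀ f → VAny.Any (f ∈T_) ts → fs V f ⊎ (Σ ℕ λ x → x VMem.∈ (xs ++ ys) × f ≡ obj x)) →
                  (bs : Vec (D I) m) →
                  H n (λ as → R (evalTs ((fun I [ xs ↦* as ]) [ ys ↦* bs ]) ts))
    complement  : ∀ {k} {R} → H k R → H k (λ as → ¬ R as)
    intersect   : ∀ {k} {R S} → H k R → H k S → H k (λ as → R as × S as)
    universal   : ∀ {k} {R} → H (suc k) R → H k (λ as → ∀ a → R (as ∷ʳ a))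

-- Fix Φ and a structure I; O = I restricted to Par(Φ).
-- Elements of 𝒮 (expansions of O) are given by their interpretation of
-- the defined predicates: expand Φ I R interprets P ∈ Def(Φ) as R P and
-- every other predicate as in I (= O).  Domain and function symbols are
-- those of O.

expand : (Φ : List Rule) (I : Structure) → Rels (D I) → Rels (D I)
expand Φ I R p with defined? Φ p
... | yes _ = R p
... | no _ = rel I p

module _ (Φ : List Rule) (I : Structure) where

  _⊑_ : Rels (D I) → Rels (D I) → Set
  J ⊑ J' = ∀ p → Defined Φ p → ∀ as → J p as → J' p as

  Cop : Rels (D I) → Rels (D I) → Rels (D I)
  Cop J J' = expand Φ I (λ p as →
    SatC (fun I [ freshYs Φ (ar p) ↦* as ]) J J' (mergedBody Φ p (freshYs Φ (ar p))))

  HPoint : HClass (D I) → Rels (D I) → Set₁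
  HPoint H J = ∀ p → Defined Φ p → H (ar p) (J p)

  record IsHenkinModel (H : HClass (D I)) : Set₂ where
    private
      Î = expand Φ I (rel I)
    field
      henkin  : IsHenkinClass (SymV Φ) I H
      point   : HPoint H Î
      prefix  : Cop Î Î ⊑ Î
      least   : ∀ R → HPoint H (expand Φ I R) →
                Cop (expand Φ I R) Î ⊑ expand Φ I R → Î ⊑ expand Φ I R

_,_⊨H_ : (I : Structure) → HClass (D I) → List Rule → Set₂
I , H ⊨H Φ = IsHenkinModel Φ I H

-- Write C for the operator of the Henkin model and Î for the interpretation of I viewed as a
-- point of 𝒮. That Î is pre-fixed, C(Î, Î) ⊑ Î, gives φ_P ⇒ P. For P ⇒ φ_P apply leastness to
-- J = C(Î, Î): J is pre-fixed because C is monotone in its first argument and J ⊑ Î, and J is an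
-- H-point because, by the closure conditions (i)–(vii) and excluded middle, every formula whose
-- free symbols lie in the vocabulary or among a tuple of distinct object symbols defines a
-- relation in the Henkin class. Hence Î ⊑ J. On the diagonal C(Î, Î) agrees classically with
-- ordinary satisfaction. Finally, C evaluates φ_P at canonical fresh names; since ȳ is also
-- fresh for the rules of P, renaming one tuple into the other does not change φ_P.
module Submission where

open import Defs
open import Level using (0ℓ)
open import Axiom.ExcludedMiddle using (ExcludedMiddle)
open import Axiom.DoubleNegationElimination using (em⇒dne)
open import Data.Nat using (ℕ; zero; suc; _≤_; _⊔_)
open import Data.Nat.Properties
  using (≤-refl; ≤-trans; n≤1+n; m≤m⊔n; m≤n⊔m; m≤n⇒m≤n⊔o; m≤n⇒m≤o⊔n; <-irrefl; <⇒≢; <⇒≱)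
  renaming (_≟_ to _≟ℕ_)
open import Data.Fin using (Fin)
open import Data.List as List using (List; []; _∷_)
open import Data.List.Membership.Propositional using (_∈_; find; lose)
import Data.List.Relation.Unary.Any as ListAny
import Data.List.Relation.Unary.All as ListAll
open import Data.List.Relation.Unary.Any.Properties using (concatMap⁺; concatMap⁻)
open import Data.Vec using (Vec; []; _∷_; _∷ʳ_; _++_; map; lookup; toList; _[_]≔_)
open import Data.Vec.Properties using (map-[]≔; ∷-injective)
open import Data.Vec.Relation.Unary.Any as Any using (Any; here; there; any?)
open import Data.Vec.Relation.Unary.Any.Properties using (lookup-index)
import Data.Vec.Relation.Unary.All as All
import Data.Vec.Relation.Unary.AllPairs.Properties as AllPairs
open import Data.Vec.Relation.Unary.AllPairs using ([]; _∷_)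
open import Data.Vec.Relation.Unary.Unique.Propositional using (Unique)
open import Data.Vec.Membership.Propositional
  using (_∉_) renaming (_∈_ to _∈ᵥ_; find to findᵥ; lose to loseᵥ)
open import Data.Vec.Membership.Propositional.Properties using (∈-++⁺ˡ; ∈-toList⁺; ∈-lookup)
open import Data.Product as Product using (Σ; _×_; _,_; proj₁; proj₂)
open import Data.Product.Function.NonDependent.Propositional using (_×-⇔_)
open import Data.Sum as Sum using (_⊎_; inj₁; inj₂)
open import Data.Sum.Function.Propositional using (_⊎-⇔_)
open import Data.Unit using (⊤; tt)
open import Function using (_∘_; _$_; id; const)
open import Function.Bundles using (_⇔_; mk⇔; Equivalence)
import Function.Properties.Equivalence as ⇔
open import Function.Related.TypeIsomorphisms using (¬-cong-⇔; →-cong-⇔)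
open import Relation.Nullary using (¬_; yes; no; contradiction; toSum)
open import Relation.Unary using (Pred; _⊆_)
open import Relation.Binary.PropositionalEquality
  using (_≡_; _≢_; _≗_; refl; sym; trans; cong; cong₂; subst; subst₂; module ≡-Reasoning)

open Equivalence using (to; from)

≡⇒⇔ : ∀ {A B : Set} → A ≡ B → A ⇔ B
≡⇒⇔ refl = ⇔.refl

∀-cong-⇔ : ∀ {A : Set} {B C : A → Set} → (∀ a → B a ⇔ C a) → (∀ a → B a) ⇔ (∀ a → C a)
∀-cong-⇔ e = mk⇔ (λ g a → e a .to (g a)) (λ g a → e a .from (g a))

Σ-cong-⇔ : ∀ {A : Set} {B C : A → Set} → (∀ a → B a ⇔ C a) → Σ A B ⇔ Σ A C
Σ-cong-⇔ e = mk⇔ (Product.map₂ (e _ .to)) (Product.map₂ (e _ .from))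

¬⊎⇔→ : ExcludedMiddle 0ℓ → ∀ {A B : Set} → (¬ A ⊎ B) ⇔ (A → B)
¬⊎⇔→ em = mk⇔ (λ { (inj₁ ¬a) a → contradiction a ¬a ; (inj₂ b) _ → b })
              (λ g → Sum.swap (Sum.map₁ g (toSum em)))

module _ {A : Set} {P : A → Set} where

  Any-∷ʳ⁺ˡ : ∀ {n x} {xs : Vec A n} → Any P xs → Any P (xs ∷ʳ x)
  Any-∷ʳ⁺ˡ (here p) = here p
  Any-∷ʳ⁺ˡ (there a) = there (Any-∷ʳ⁺ˡ a)

  Any-∷ʳ⁺ʳ : ∀ {n x} (xs : Vec A n) → P x → Any P (xs ∷ʳ x)
  Any-∷ʳ⁺ʳ [] p = here p
  Any-∷ʳ⁺ʳ (_ ∷ xs) p = there (Any-∷ʳ⁺ʳ xs p)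

  Any-[]≔⁻ : ∀ {n x} (xs : Vec A n) i → Any P (xs [ i ]≔ x) → Any P (xs ∷ʳ x)
  Any-[]≔⁻ (_ ∷ xs) Fin.zero (here p) = there (Any-∷ʳ⁺ʳ xs p)
  Any-[]≔⁻ (_ ∷ xs) Fin.zero (there a) = there (Any-∷ʳ⁺ˡ a)
  Any-[]≔⁻ (_ ∷ xs) (Fin.suc i) (here p) = here p
  Any-[]≔⁻ (_ ∷ xs) (Fin.suc i) (there a) = there (Any-[]≔⁻ xs i a)

  All-∷ʳ : ∀ {n x} {xs : Vec A n} → All.All P xs → P x → All.All P (xs ∷ʳ x)
  All-∷ʳ All.[] p = p All.∷ All.[]
  All-∷ʳ (q All.∷ qs) p = q All.∷ All-∷ʳ qs p

module _ {A : Set} where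

  Unique-∷ʳ : ∀ {n x} {xs : Vec A n} → Unique xs → x ∉ xs → Unique (xs ∷ʳ x)
  Unique-∷ʳ [] _ = All.[] ∷ []
  Unique-∷ʳ (x₀∉xs ∷ u) x∉ = All-∷ʳ x₀∉xs (λ e → x∉ (here (sym e))) ∷ Unique-∷ʳ u (x∉ ∘ there)

  Unique-++[] : ∀ {n} {xs : Vec A n} → Unique xs → Unique (xs ++ [])
  Unique-++[] u = AllPairs.++⁺ u [] (All.universal (λ _ → All.[]) _)

≤-foldr-⊔ : ∀ {x} (xs : List ℕ) → x ∈ xs → x ≤ List.foldr _⊔_ 0 xs
≤-foldr-⊔ (y ∷ xs) (ListAny.here refl) = m≤m⊔n y _
≤-foldr-⊔ (y ∷ xs) (ListAny.there x∈xs) = ≤-trans (≤-foldr-⊔ xs x∈xs) (m≤n⊔m y _)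

fresh : ∀ {n} → Vec ℕ n → ℕ
fresh zs = suc (List.foldr _⊔_ 0 (toList zs))

fresh-∉ : ∀ {n} (zs : Vec ℕ n) → fresh zs ∉ zs
fresh-∉ zs z∈zs = <-irrefl refl (≤-foldr-⊔ (toList zs) (∈-toList⁺ z∈zs))

_∈ᵒ_ : ∀ {n} → FSym → Vec ℕ n → Set
f ∈ᵒ zs = Any (λ z → f ≡ obj z) zs

obj-injective : ∀ {x y} → obj x ≡ obj y → x ≡ y
obj-injective = cong proj₁

∉⇒∉ᵒ : ∀ {x n} {ws : Vec ℕ n} → x ∉ ws → ¬ obj x ∈ᵒ ws
∉⇒∉ᵒ x∉ws = x∉ws ∘ Any.map obj-injective

All≢⇒∉ᵒ : ∀ {x n} {ws : Vec ℕ n} → All.All (x ≢_) ws → ¬ obj x ∈ᵒ ws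
All≢⇒∉ᵒ = All.lookupWith (λ x≢z e → x≢z (obj-injective e))

var-∈T : ∀ {f x} → f ∈T var x → f ≡ obj x
var-∈T here = refl
var-∈T (under ())

map-var-∈T : ∀ {n f} (xs : Vec ℕ n) → Any (f ∈T_) (map var xs) → f ∈ᵒ xs
map-var-∈T (_ ∷ _) (here m) = here (var-∈T m)
map-var-∈T (_ ∷ xs) (there a) = there (map-var-∈T xs a)

Free : Formula → Pred FSym 0ℓ
Free φ f = FreeIn f φ

Preds : Formula → Pred PSym 0ℓ
Preds φ p = PredIn p φ

Free-∀⁻ : ∀ {x φ f} → FreeIn f φ → f ≡ obj x ⊎ FreeIn f (∀' x φ)
Free-∀⁻ {x} {f = f} fr with f ≟S obj x
... | yes f≡x = inj₁ f≡x
... | no f≢x = inj₂ (all f≢x fr)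

module _ {f : FSym} where

  FreeIn-⋁⁻ : ∀ φs → FreeIn f (⋁ φs) → ListAny.Any (FreeIn f) φs
  FreeIn-⋁⁻ (φ ∷ []) fr = ListAny.here fr
  FreeIn-⋁⁻ (φ ∷ ψ ∷ φs) (orˡ fr) = ListAny.here fr
  FreeIn-⋁⁻ (φ ∷ ψ ∷ φs) (orʳ fr) = ListAny.there (FreeIn-⋁⁻ (ψ ∷ φs) fr)

  FreeIn-⋀⁻ : ∀ φs → FreeIn f (⋀ φs) → ListAny.Any (FreeIn f) φs
  FreeIn-⋀⁻ (φ ∷ []) fr = ListAny.here fr
  FreeIn-⋀⁻ (φ ∷ ψ ∷ φs) (andˡ fr) = ListAny.here fr
  FreeIn-⋀⁻ (φ ∷ ψ ∷ φs) (andʳ fr) = ListAny.there (FreeIn-⋀⁻ (ψ ∷ φs) fr)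

module _ {q : PSym} where

  PredIn-⋁⁻ : ∀ φs → PredIn q (⋁ φs) → ListAny.Any (PredIn q) φs
  PredIn-⋁⁻ (φ ∷ []) pr = ListAny.here pr
  PredIn-⋁⁻ (φ ∷ ψ ∷ φs) (orˡ pr) = ListAny.here pr
  PredIn-⋁⁻ (φ ∷ ψ ∷ φs) (orʳ pr) = ListAny.there (PredIn-⋁⁻ (ψ ∷ φs) pr)

  PredIn-⋀⁻ : ∀ φs → PredIn q (⋀ φs) → ListAny.Any (PredIn q) φs
  PredIn-⋀⁻ (φ ∷ []) pr = ListAny.here pr
  PredIn-⋀⁻ (φ ∷ ψ ∷ φs) (andˡ pr) = ListAny.here pr
  PredIn-⋀⁻ (φ ∷ ψ ∷ φs) (andʳ pr) = ListAny.there (PredIn-⋀⁻ (ψ ∷ φs) pr)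

-- Assignments and the coincidence lemma

module _ {D : Set} where

  Agree : Pred FSym 0ℓ → Funs D → Funs D → Set
  Agree S F G = ∀ f → S f → F f ≗ G f

  Agree-sym : ∀ {S F G} → Agree S F G → Agree S G F
  Agree-sym agr f s v = sym (agr f s v)

  Agree-⊆ : ∀ {S T} {F G : Funs D} → S ⊆ T → Agree T F G → Agree S F G
  Agree-⊆ S⊆T agr f = agr f ∘ S⊆T

  update-≡ : ∀ (F : Funs D) x a → (F [ x ↦ a ]) (obj x) ≗ const a
  update-≡ F x a v with obj x ≟S obj x
  ... | yes refl = refl
  ... | no x≢x = contradiction refl x≢x

  update-≢ : ∀ (F : Funs D) {x a f} → f ≢ obj x → (F [ x ↦ a ]) f ≗ F f
  update-≢ F {x} {f = f} f≢x v with f ≟S obj x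
  ... | yes f≡x = contradiction f≡x f≢x
  ... | no _ = refl

  update-agree : ∀ {S T} {F G : Funs D} x a → (∀ {f} → T f → f ≢ obj x → S f) →
                 Agree S F G → Agree T (F [ x ↦ a ]) (G [ x ↦ a ])
  update-agree x a T⇒S agr f t v with f ≟S obj x
  ... | yes refl = refl
  ... | no f≢x = agr f (T⇒S t f≢x) v

  update*-agree : ∀ {S} {F G : Funs D} {n} (ws : Vec ℕ n) cs →
                  Agree S F G → Agree S (F [ ws ↦* cs ]) (G [ ws ↦* cs ])
  update*-agree [] [] agr = agr
  update*-agree (w ∷ ws) (c ∷ cs) agr = update*-agree ws cs (update-agree w c (λ s _ → s) agr)

  update*-∉ : ∀ (F : Funs D) {n} (ws : Vec ℕ n) cs {f} → ¬ f ∈ᵒ ws → (F [ ws ↦* cs ]) f ≗ F f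
  update*-∉ F [] [] _ v = refl
  update*-∉ F (w ∷ ws) (c ∷ cs) f∉ws v =
    trans (update*-∉ (F [ w ↦ c ]) ws cs (f∉ws ∘ there) v) (update-≢ F (f∉ws ∘ here) v)

  update*-∷ʳ : ∀ (F : Funs D) {n} (zs : Vec ℕ n) as x a →
               F [ zs ∷ʳ x ↦* as ∷ʳ a ] ≡ (F [ zs ↦* as ]) [ x ↦ a ]
  update*-∷ʳ F [] [] x a = refl
  update*-∷ʳ F (z ∷ zs) (b ∷ as) x a = update*-∷ʳ (F [ z ↦ b ]) zs as x a

  update*-lookup : ∀ (F : Funs D) {n} {zs : Vec ℕ n} as a i → Unique zs → ∀ f →
                   ((F [ zs ↦* as ]) [ lookup zs i ↦ a ]) f ≗ (F [ zs ↦* as [ i ]≔ a ]) f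
  update*-lookup F {zs = z ∷ zs} (b ∷ as) a Fin.zero (z∉zs ∷ _) f v with f ≟S obj z
  ... | yes refl = sym (trans (update*-∉ (F [ z ↦ a ]) zs as (All≢⇒∉ᵒ z∉zs) v) (update-≡ F z a v))
  ... | no f≢z = update*-agree {S = _≢ obj z} zs as F[z↦b]≈F[z↦a] f f≢z v
    where
    F[z↦b]≈F[z↦a] : Agree (_≢ obj z) (F [ z ↦ b ]) (F [ z ↦ a ])
    F[z↦b]≈F[z↦a] g g≢z v = trans (update-≢ F g≢z v) (sym (update-≢ F g≢z v))
  update*-lookup F {zs = z ∷ zs} (b ∷ as) a (Fin.suc i) (_ ∷ u) = update*-lookup (F [ z ↦ b ]) as a i u

  mutual
    evalT-agree : ∀ {F G : Funs D} t → Agree (_∈T t) F G → evalT F t ≡ evalT G t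
    evalT-agree {F} {G} (app f ts) agr =
      trans (cong (F f) (evalTs-agree ts (Agree-⊆ under agr))) (agr f here (evalTs G ts))

    evalTs-agree : ∀ {F G : Funs D} {n} (ts : Vec Term n) → Agree (λ f → Any (f ∈T_) ts) F G →
                   evalTs F ts ≡ evalTs G ts
    evalTs-agree [] agr = refl
    evalTs-agree (t ∷ ts) agr =
      cong₂ _∷_ (evalT-agree t (Agree-⊆ here agr)) (evalTs-agree ts (Agree-⊆ there agr))

  evalTs-map-var : ∀ (F : Funs D) {n} (ws : Vec ℕ n) →
                   evalTs F (map var ws) ≡ map (λ w → F (obj w) []) ws
  evalTs-map-var F [] = refl
  evalTs-map-var F (w ∷ ws) = cong (_ ∷_) (evalTs-map-var F ws)

  evalTs-update-∉ : ∀ (F : Funs D) {x a n} {ws : Vec ℕ n} → x ∉ ws →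
                    evalTs (F [ x ↦ a ]) (map var ws) ≡ evalTs F (map var ws)
  evalTs-update-∉ F {ws = ws} x∉ws =
    evalTs-agree (map var ws) λ f f∈ → update-≢ F λ { refl → ∉⇒∉ᵒ x∉ws (map-var-∈T ws f∈) }

  evalTs-update*-self : ∀ (F : Funs D) {n} {ws : Vec ℕ n} cs → Unique ws →
                        evalTs (F [ ws ↦* cs ]) (map var ws) ≡ cs
  evalTs-update*-self F {ws = []} [] [] = refl
  evalTs-update*-self F {ws = w ∷ ws} (c ∷ cs) (w∉ws ∷ u) =
    cong₂ _∷_ (trans (update*-∉ (F [ w ↦ c ]) ws cs (All≢⇒∉ᵒ w∉ws) []) (update-≡ F w c []))
              (evalTs-update*-self (F [ w ↦ c ]) cs u)

  evalTs-[]≔ : ∀ (F : Funs D) {n} {zs : Vec ℕ n} {z′} as a i → Unique zs → z′ ∉ zs →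
               evalTs (F [ zs ∷ʳ z′ ↦* as ∷ʳ a ]) (map var (zs [ i ]≔ z′)) ≡ as [ i ]≔ a
  evalTs-[]≔ F {zs = zs} {z′} as a i u z′∉zs rewrite update*-∷ʳ F zs as z′ a = begin
    evalTs G (map var (zs [ i ]≔ z′))  ≡⟨ evalTs-map-var G (zs [ i ]≔ z′) ⟩
    map g (zs [ i ]≔ z′)               ≡⟨ map-[]≔ g zs i ⟩
    map g zs [ i ]≔ g z′               ≡⟨ cong₂ (λ xs x → xs [ i ]≔ x) g[zs]≡as (update-≡ F′ z′ a []) ⟩
    as [ i ]≔ a                        ∎
    where
    open ≡-Reasoning
    F′ = F [ zs ↦* as ]
    G = F′ [ z′ ↦ a ]
    g = λ w → G (obj w) []
    g[zs]≡as : map g zs ≡ as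
    g[zs]≡as = begin
      map g zs                ≡⟨ sym (evalTs-map-var G zs) ⟩
      evalTs G (map var zs)   ≡⟨ evalTs-update-∉ F′ z′∉zs ⟩
      evalTs F′ (map var zs)  ≡⟨ evalTs-update*-self F as u ⟩
      as                      ∎

  Sat-cong : ∀ {F G : Funs D} {R} φ → Agree (Free φ) F G → Sat F R φ ⇔ Sat G R φ
  Sat-cong ⊤' agr = ⇔.refl
  Sat-cong ⊥' agr = ⇔.refl
  Sat-cong {R = R} (atom p ts) agr = mk⇔ (subst (R p) ts≡) (subst (R p) (sym ts≡))
    where ts≡ = evalTs-agree ts (Agree-⊆ atom agr)
  Sat-cong (t ≐' u) agr
    rewrite evalT-agree t (Agree-⊆ eqˡ agr) | evalT-agree u (Agree-⊆ eqʳ agr) = ⇔.refl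
  Sat-cong (¬' φ) agr = ¬-cong-⇔ (Sat-cong φ (Agree-⊆ neg agr))
  Sat-cong (φ ∧' ψ) agr = Sat-cong φ (Agree-⊆ andˡ agr) ×-⇔ Sat-cong ψ (Agree-⊆ andʳ agr)
  Sat-cong (φ ∨' ψ) agr = Sat-cong φ (Agree-⊆ orˡ agr) ⊎-⇔ Sat-cong ψ (Agree-⊆ orʳ agr)
  Sat-cong (φ ⇒' ψ) agr = →-cong-⇔ (Sat-cong φ (Agree-⊆ impˡ agr)) (Sat-cong ψ (Agree-⊆ impʳ agr))
  Sat-cong (φ ⇔' ψ) agr = →-cong-⇔ eφ eψ ×-⇔ →-cong-⇔ eψ eφ
    where
    eφ = Sat-cong φ (Agree-⊆ iffˡ agr)
    eψ = Sat-cong ψ (Agree-⊆ iffʳ agr)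
  Sat-cong (∀' x φ) agr = ∀-cong-⇔ λ a → Sat-cong φ (update-agree x a (λ fr f≢x → all f≢x fr) agr)
  Sat-cong (∃' x φ) agr = Σ-cong-⇔ λ a → Sat-cong φ (update-agree x a (λ fr f≢x → ex f≢x fr) agr)

module _ {D : Set} {F : Funs D} {R : Rels D} where

  Sat-⋁ : ∀ φs → Sat F R (⋁ φs) ⇔ ListAny.Any (Sat F R) φs
  Sat-⋁ [] = mk⇔ (λ ()) (λ ())
  Sat-⋁ (φ ∷ []) = mk⇔ ListAny.here λ { (ListAny.here s) → s ; (ListAny.there ()) }
  Sat-⋁ (φ ∷ ψ ∷ φs) = ⇔.trans (⇔.refl ⊎-⇔ Sat-⋁ (ψ ∷ φs)) (mk⇔ ListAny.fromSum ListAny.toSum)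

  Sat-⋀ : ∀ φs → Sat F R (⋀ φs) ⇔ ListAll.All (Sat F R) φs
  Sat-⋀ [] = mk⇔ (const ListAll.[]) (const tt)
  Sat-⋀ (φ ∷ []) = mk⇔ (ListAll._∷ ListAll.[]) ListAll.head
  Sat-⋀ (φ ∷ ψ ∷ φs) =
    ⇔.trans (⇔.refl ×-⇔ Sat-⋀ (ψ ∷ φs)) (mk⇔ (Product.uncurry ListAll._∷_) ListAll.uncons)

  Sat-eqs : ∀ {k} (ys : Vec ℕ k) ts → Sat F R (⋀ (eqs ys ts)) ⇔ (evalTs F (map var ys) ≡ evalTs F ts)
  Sat-eqs ys ts = ⇔.trans (Sat-⋀ (eqs ys ts)) (All-eqs ys ts)
    where
    All-eqs : ∀ {k} (ys : Vec ℕ k) ts →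
              ListAll.All (Sat F R) (eqs ys ts) ⇔ (evalTs F (map var ys) ≡ evalTs F ts)
    All-eqs [] [] = mk⇔ (const refl) (const ListAll.[])
    All-eqs (y ∷ ys) (t ∷ ts) =
      ⇔.trans (mk⇔ ListAll.uncons (Product.uncurry ListAll._∷_))
              (⇔.trans (⇔.refl ×-⇔ All-eqs ys ts) (mk⇔ (Product.uncurry (cong₂ _∷_)) ∷-injective))

∀*-intro : ∀ {D} {F : Funs D} {R n} (ys : Vec ℕ n) ψ →
           (∀ as → Sat (F [ ys ↦* as ]) R ψ) → Sat F R (∀* ys ψ)
∀*-intro [] ψ h = h []
∀*-intro (y ∷ ys) ψ h a = ∀*-intro ys ψ (h ∘ (a ∷_))

module _ {D : Set} where

  _⊆ᴿ_ : Rels D → Rels D → Set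
  J ⊆ᴿ J′ = ∀ p as → J p as → J′ p as

  SatC-mono : ∀ {F : Funs D} {J J′ K K′} φ → J ⊆ᴿ J′ → K′ ⊆ᴿ K → SatC F J K φ → SatC F J′ K′ φ
  SatC-mono ⊤' j k = id
  SatC-mono ⊥' j k = id
  SatC-mono (atom p ts) j k = j p _
  SatC-mono (t ≐' u) j k = id
  SatC-mono (¬' φ) j k ¬c = ¬c ∘ SatC-mono φ k j
  SatC-mono (φ ∧' ψ) j k = Product.map (SatC-mono φ j k) (SatC-mono ψ j k)
  SatC-mono (φ ∨' ψ) j k = Sum.map (SatC-mono φ j k) (SatC-mono ψ j k)
  SatC-mono (φ ⇒' ψ) j k = Sum.map (_∘ SatC-mono φ k j) (SatC-mono ψ j k)
  SatC-mono (φ ⇔' ψ) j k =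
    Product.map (Sum.map (_∘ SatC-mono φ k j) (SatC-mono ψ j k))
                (Sum.map (_∘ SatC-mono ψ k j) (SatC-mono φ j k))
  SatC-mono (∀' x φ) j k g a = SatC-mono φ j k (g a)
  SatC-mono (∃' x φ) j k = Product.map₂ (SatC-mono φ j k)

  SatC-diag : ExcludedMiddle 0ℓ → ∀ {F : Funs D} {R} φ → SatC F R R φ ⇔ Sat F R φ
  SatC-diag em ⊤' = ⇔.refl
  SatC-diag em ⊥' = ⇔.refl
  SatC-diag em (atom p ts) = ⇔.refl
  SatC-diag em (t ≐' u) = ⇔.refl
  SatC-diag em (¬' φ) = ¬-cong-⇔ (SatC-diag em φ)
  SatC-diag em (φ ∧' ψ) = SatC-diag em φ ×-⇔ SatC-diag em ψ
  SatC-diag em (φ ∨' ψ) = SatC-diag em φ ⊎-⇔ SatC-diag em ψ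
  SatC-diag em (φ ⇒' ψ) = ⇔.trans (¬-cong-⇔ (SatC-diag em φ) ⊎-⇔ SatC-diag em ψ) (¬⊎⇔→ em)
  SatC-diag em (φ ⇔' ψ) =
    ⇔.trans (¬-cong-⇔ (SatC-diag em φ) ⊎-⇔ SatC-diag em ψ) (¬⊎⇔→ em) ×-⇔
    ⇔.trans (¬-cong-⇔ (SatC-diag em ψ) ⊎-⇔ SatC-diag em φ) (¬⊎⇔→ em)
  SatC-diag em (∀' x φ) = ∀-cong-⇔ λ _ → SatC-diag em φ
  SatC-diag em (∃' x φ) = Σ-cong-⇔ λ _ → SatC-diag em φ

-- Definability in a Henkin class

module Definability (em : ExcludedMiddle 0ℓ) {V : Vocab} {I : Structure} {H : HClass (D I)}
                    (isHenkin : IsHenkinClass V I H) where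
  open IsHenkinClass isHenkin

  private
    dne = em⇒dne em

  InScope : ∀ {n} → Vec ℕ n → Pred FSym 0ℓ
  InScope zs f = fs V f ⊎ f ∈ᵒ zs

  ⟦_⟧[_] : ∀ {n} → Formula → Vec ℕ n → Vec (D I) n → Set
  ⟦ φ ⟧[ zs ] as = Sat (fun I [ zs ↦* as ]) (rel I) φ

  Definable : Formula → Set₁
  Definable φ = ∀ {n} (zs : Vec ℕ n) → Unique zs → Free φ ⊆ InScope zs → H n ⟦ φ ⟧[ zs ]

  H-substitute : ∀ {k n R} → H k R → (ts : Vec Term k) (zs : Vec ℕ n) → Unique zs →
                 (λ f → Any (f ∈T_) ts) ⊆ InScope zs → H n (λ as → R (evalTs (fun I [ zs ↦* as ]) ts))
  H-substitute h ts zs u scope =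
    substitute h ts zs [] (Unique-++[] u) (λ _ → Sum.map₂ ∈ᵒ⇒∈-++ ∘ scope) []
    where
    ∈ᵒ⇒∈-++ : ∀ {f} → f ∈ᵒ zs → Σ ℕ λ z → z ∈ᵥ zs ++ [] × f ≡ obj z
    ∈ᵒ⇒∈-++ = Product.map₂ (Product.map₁ ∈-++⁺ˡ) ∘ findᵥ

  H-⊤ : ∀ {n} {zs : Vec ℕ n} → Unique zs → H n (λ _ → ⊤)
  H-⊤ {zs = zs} u = extensional (complement (intersect S (complement S))) λ _ → mk⇔ _ λ _ (s , ¬s) → ¬s s
    where S = H-substitute (universal (universal diag)) [] zs u λ ()

  H-⊎ : ∀ {n A B} → H n A → H n B → H n (λ as → A as ⊎ B as)
  H-⊎ hA hB = extensional (complement (intersect (complement hA) (complement hB))) λ _ → mk⇔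
    (λ ¬¬a⊎b → dne λ ¬a⊎b → ¬¬a⊎b (¬a⊎b ∘ inj₁ , ¬a⊎b ∘ inj₂))
    (λ a⊎b (¬a , ¬b) → Sum.[ ¬a , ¬b ]′ a⊎b)

  H-→ : ∀ {n A B} → H n A → H n B → H n (λ as → A as → B as)
  H-→ hA hB = extensional (complement (intersect hA (complement hB))) λ _ → mk⇔
    (λ ¬[a×¬b] a → dne λ ¬b → ¬[a×¬b] (a , ¬b))
    (λ a→b (a , ¬b) → ¬b (a→b a))

  ∀-definable-new : ∀ {φ x n} {zs : Vec ℕ n} → Definable φ → Unique zs → x ∉ zs →
                    Free (∀' x φ) ⊆ InScope zs → H n ⟦ ∀' x φ ⟧[ zs ]
  ∀-definable-new {φ} {x} {zs = zs} defφ u x∉zs scope =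
    extensional (universal (defφ (zs ∷ʳ x) (Unique-∷ʳ u x∉zs) scope′)) λ as →
      ∀-cong-⇔ λ a → ≡⇒⇔ (cong (λ G → Sat G (rel I) φ) (update*-∷ʳ (fun I) zs as x a))
    where
    scope′ : Free φ ⊆ InScope (zs ∷ʳ x)
    scope′ fr = Sum.[ inj₂ ∘ Any-∷ʳ⁺ʳ zs , Sum.map₂ Any-∷ʳ⁺ˡ ∘ scope ]′ (Free-∀⁻ fr)

  -- The bound x already names the i-th coordinate, so (vii) cannot quantify over it directly:
  -- append a fresh z′, substitute it for x in the argument list, and quantify over z′ instead.
  ∀-definable-shadowing : ∀ {φ x n} {zs : Vec ℕ n} i → lookup zs i ≡ x → Definable φ → Unique zs →
                          Free (∀' x φ) ⊆ InScope zs → H n ⟦ ∀' x φ ⟧[ zs ]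
  ∀-definable-shadowing {φ} {zs = zs} i refl defφ u scope =
    extensional (universal (H-substitute (defφ zs u scope′) (map var (zs [ i ]≔ z′)) (zs ∷ʳ z′)
                                         (Unique-∷ʳ u (fresh-∉ zs)) scope-z′)) λ as → ∀-cong-⇔ λ a →
        ⇔.trans (≡⇒⇔ (cong ⟦ φ ⟧[ zs ] (evalTs-[]≔ (fun I) as a i u (fresh-∉ zs))))
                (Sat-cong φ λ f _ v → sym (update*-lookup (fun I) as a i u f v))
    where
    z′ = fresh zs
    scope-z′ : (λ f → Any (f ∈T_) (map var (zs [ i ]≔ z′))) ⊆ InScope (zs ∷ʳ z′)
    scope-z′ = inj₂ ∘ Any-[]≔⁻ zs i ∘ map-var-∈T _
    scope′ : Free φ ⊆ InScope zs
    scope′ fr = Sum.[ inj₂ ∘ loseᵥ (∈-lookup i zs) , scope ]′ (Free-∀⁻ fr)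

  ∀-definable : ∀ {φ} x → Definable φ → Definable (∀' x φ)
  ∀-definable x defφ zs u scope with any? (x ≟ℕ_) zs
  ... | no x∉zs = ∀-definable-new defφ u x∉zs scope
  ... | yes x∈zs = ∀-definable-shadowing (Any.index x∈zs) (sym (lookup-index x∈zs)) defφ u scope

  ∃-definable : ∀ {φ} x → Definable φ → Definable (∃' x φ)
  ∃-definable {φ} x defφ zs u scope =
    extensional (complement (∀-definable x ¬defφ zs u scope′)) λ _ → mk⇔
      (λ ¬∀¬ → dne λ ¬∃ → ¬∀¬ λ a s → ¬∃ (a , s))
      (λ (a , s) ∀¬ → ∀¬ a s)
    where
    ¬defφ : Definable (¬' φ)
    ¬defφ ws u′ scope-ws = complement (defφ ws u′ (scope-ws ∘ neg))
    scope′ : Free (∀' x (¬' φ)) ⊆ InScope zs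
    scope′ (all x≢f (neg fr)) = scope (ex x≢f fr)

  definable : ∀ φ → Preds φ ⊆ ps V → Definable φ
  definable ⊤' _ zs u _ = H-⊤ u
  definable ⊥' _ zs u _ = extensional (complement (H-⊤ u)) λ _ → mk⇔ (_$ tt) λ ()
  definable (atom p ts) inV zs u scope = H-substitute (preds p (inV atom)) ts zs u (scope ∘ atom)
  definable (t ≐' t′) _ zs u scope = H-substitute diag (t ∷ t′ ∷ []) zs u
    λ { (here m) → scope (eqˡ m) ; (there (here m)) → scope (eqʳ m) }
  definable (¬' φ) inV zs u scope = complement (definable φ (inV ∘ neg) zs u (scope ∘ neg))
  definable (φ ∧' ψ) inV zs u scope =
    intersect (definable φ (inV ∘ andˡ) zs u (scope ∘ andˡ))
              (definable ψ (inV ∘ andʳ) zs u (scope ∘ andʳ))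
  definable (φ ∨' ψ) inV zs u scope =
    H-⊎ (definable φ (inV ∘ orˡ) zs u (scope ∘ orˡ))
        (definable ψ (inV ∘ orʳ) zs u (scope ∘ orʳ))
  definable (φ ⇒' ψ) inV zs u scope =
    H-→ (definable φ (inV ∘ impˡ) zs u (scope ∘ impˡ))
        (definable ψ (inV ∘ impʳ) zs u (scope ∘ impʳ))
  definable (φ ⇔' ψ) inV zs u scope = intersect (H-→ hφ hψ) (H-→ hψ hφ)
    where
    hφ = definable φ (inV ∘ iffˡ) zs u (scope ∘ iffˡ)
    hψ = definable ψ (inV ∘ iffʳ) zs u (scope ∘ iffʳ)
  definable (∀' x φ) inV = ∀-definable x (definable φ (inV ∘ all))
  definable (∃' x φ) inV = ∃-definable x (definable φ (inV ∘ ex))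

-- Merged bodies

clause : List ℕ → ∀ {k} → Vec ℕ k → Vec Term k → Formula → Formula
clause xs ys ts ψ = ∃* xs (⋀ (eqs ys ts) ∧' ψ)

Fresh : List ℕ → ∀ {k} → Vec Term k → Formula → ∀ {n} → Vec ℕ n → Set
Fresh xs ts ψ ys = ∀ y → y ∈ᵥ ys → ¬ FreeIn (obj y) ψ × ¬ Any (obj y ∈T_) ts × ¬ (y ∈ xs)

FreshFor : List Rule → (P : PSym) → Vec ℕ (ar P) → Set
FreshFor Φ P ys = ∀ r → r ∈ Φ → head r ≡ P → Fresh (vars r) (args r) (body r) ys

module _ {xs k n} {ts : Vec Term k} {ψ} {ys : Vec ℕ n} (ys-fresh : Fresh xs ts ψ ys) where

  Fresh-args : (λ f → Any (f ∈T_) ts) ⊆ (λ f → ¬ f ∈ᵒ ys)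
  Fresh-args a f∈ys with findᵥ f∈ys
  ... | y , y∈ys , refl = proj₁ (proj₂ (ys-fresh y y∈ys)) a

  Fresh-body : Free ψ ⊆ (λ f → ¬ f ∈ᵒ ys)
  Fresh-body fr f∈ys with findᵥ f∈ys
  ... | y , y∈ys , refl = proj₁ (ys-fresh y y∈ys) fr

Fresh-∷⁻ : ∀ {x xs k n} {ts : Vec Term k} {ψ} {ys : Vec ℕ n} →
           Fresh (x ∷ xs) ts ψ ys → x ∉ ys × Fresh xs ts ψ ys
Fresh-∷⁻ ys-fresh = (λ x∈ys → proj₂ (proj₂ (ys-fresh _ x∈ys)) (ListAny.here refl)) ,
                    (λ y y∈ys → Product.map₂ (Product.map₂ (_∘ ListAny.there)) (ys-fresh y y∈ys))

Outside : ∀ {n} → Vec ℕ n → Vec ℕ n → Pred FSym 0ℓ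
Outside ys zs f = ¬ f ∈ᵒ ys × ¬ f ∈ᵒ zs

clause-rename : ∀ {D} {F G : Funs D} {R} xs {k} (ts : Vec Term k) ψ {ys zs : Vec ℕ k} →
                Fresh xs ts ψ ys → Fresh xs ts ψ zs → Agree (Outside ys zs) F G →
                evalTs F (map var ys) ≡ evalTs G (map var zs) →
                Sat F R (clause xs ys ts ψ) → Sat G R (clause xs zs ts ψ)
clause-rename {F = F} {G} [] ts ψ {ys} {zs} ys-fresh zs-fresh agr ys≡zs (ys≡ts , s) =
  Sat-eqs zs ts .from zs≡ts , Sat-cong ψ (Agree-⊆ ψ-outside agr) .to s
  where
  open ≡-Reasoning
  ψ-outside : Free ψ ⊆ Outside ys zs
  ψ-outside fr = Fresh-body ys-fresh fr , Fresh-body zs-fresh fr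
  ts-outside : (λ f → Any (f ∈T_) ts) ⊆ Outside ys zs
  ts-outside a = Fresh-args ys-fresh a , Fresh-args zs-fresh a
  zs≡ts : evalTs G (map var zs) ≡ evalTs G ts
  zs≡ts = begin
    evalTs G (map var zs)  ≡⟨ sym ys≡zs ⟩
    evalTs F (map var ys)  ≡⟨ Sat-eqs ys ts .to ys≡ts ⟩
    evalTs F ts            ≡⟨ evalTs-agree ts (Agree-⊆ ts-outside agr) ⟩
    evalTs G ts            ∎
clause-rename {F = F} {G} (x ∷ xs) ts ψ ys-fresh zs-fresh agr ys≡zs (a , s)
  with Fresh-∷⁻ ys-fresh | Fresh-∷⁻ zs-fresh
... | x∉ys , ys-fresh′ | x∉zs , zs-fresh′ =
  a , clause-rename xs ts ψ ys-fresh′ zs-fresh′ (update-agree x a (λ o _ → o) agr)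
                    (trans (evalTs-update-∉ F x∉ys) (trans ys≡zs (sym (evalTs-update-∉ G x∉zs)))) s

module _ {D : Set} {F G : Funs D} {R : Rels D} (P : PSym) {ys zs : Vec ℕ (ar P)}
         (agr : Agree (Outside ys zs) F G) (ys≡zs : evalTs F (map var ys) ≡ evalTs G (map var zs)) where

  ruleDisjunct-rename : ∀ r → (head r ≡ P → Fresh (vars r) (args r) (body r) ys) →
                        (head r ≡ P → Fresh (vars r) (args r) (body r) zs) →
                        ListAny.Any (Sat F R) (ruleDisjunct P ys r) →
                        ListAny.Any (Sat G R) (ruleDisjunct P zs r)
  ruleDisjunct-rename r ys-fresh zs-fresh with head r ≟S P
  ... | no _ = λ ()
  ... | yes refl = λ
    { (ListAny.here s) → ListAny.here
        (clause-rename (vars r) (args r) (body r) (ys-fresh refl) (zs-fresh refl) agr ys≡zs s)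
    ; (ListAny.there ()) }

  mergedBody-rename : ∀ Φ → FreshFor Φ P ys → FreshFor Φ P zs →
                      Sat F R (mergedBody Φ P ys) → Sat G R (mergedBody Φ P zs)
  mergedBody-rename Φ ys-fresh zs-fresh s =
    let r , r∈Φ , sr = find (concatMap⁻ (ruleDisjunct P ys) (Sat-⋁ _ .to s))
    in Sat-⋁ _ .from (concatMap⁺ (ruleDisjunct P zs)
                        (lose r∈Φ (ruleDisjunct-rename r (ys-fresh r r∈Φ) (zs-fresh r r∈Φ) sr)))

mergedBody-cong : ∀ {D} {F G : Funs D} {R} Φ P {ys zs} → FreshFor Φ P ys → FreshFor Φ P zs →
                  Agree (Outside ys zs) F G → evalTs F (map var ys) ≡ evalTs G (map var zs) →
                  Sat F R (mergedBody Φ P ys) ⇔ Sat G R (mergedBody Φ P zs)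
mergedBody-cong Φ P ys-fresh zs-fresh agr ys≡zs =
  mk⇔ (mergedBody-rename P agr ys≡zs Φ ys-fresh zs-fresh)
      (mergedBody-rename P (Agree-⊆ Product.swap (Agree-sym agr)) (sym ys≡zs) Φ zs-fresh ys-fresh)

module _ {f : FSym} where

  eqs-free : ∀ {k} (ys : Vec ℕ k) ts → ListAny.Any (FreeIn f) (eqs ys ts) → Any (f ∈T_) ts ⊎ f ∈ᵒ ys
  eqs-free [] [] ()
  eqs-free (y ∷ ys) (t ∷ ts) (ListAny.here (eqˡ m)) = inj₂ (here (var-∈T m))
  eqs-free (y ∷ ys) (t ∷ ts) (ListAny.here (eqʳ m)) = inj₁ (here m)
  eqs-free (y ∷ ys) (t ∷ ts) (ListAny.there fr) = Sum.map there there (eqs-free ys ts fr)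

  clause-free : ∀ xs P ts ψ {ys} → FreeIn f (clause xs ys ts ψ) → FreeInRule f (rule xs P ts ψ) ⊎ f ∈ᵒ ys
  clause-free [] P ts ψ {ys} (andˡ fr) =
    Sum.map₁ (λ a → inj₁ a , λ _ ()) (eqs-free ys ts (FreeIn-⋀⁻ _ fr))
  clause-free [] P ts ψ (andʳ fr) = inj₁ (inj₂ fr , λ _ ())
  clause-free (x ∷ xs) P ts ψ (ex f≢x fr) = Sum.map₁ (Product.map₂ unbound-∷) (clause-free xs P ts ψ fr)
    where
    unbound-∷ : (∀ z → z ∈ xs → f ≢ obj z) → ∀ z → z ∈ x ∷ xs → f ≢ obj z
    unbound-∷ unbound z (ListAny.here refl) = f≢x
    unbound-∷ unbound z (ListAny.there z∈xs) = unbound z z∈xs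

  ruleDisjunct-free : ∀ P {ys} r → ListAny.Any (FreeIn f) (ruleDisjunct P ys r) →
                      FreeInRule f r ⊎ f ∈ᵒ ys
  ruleDisjunct-free P r with head r ≟S P
  ... | no _ = λ ()
  ... | yes refl = λ { (ListAny.here fr) → clause-free (vars r) (head r) (args r) (body r) fr
                     ; (ListAny.there ()) }

  mergedBody-free : ∀ Φ P {ys} → FreeIn f (mergedBody Φ P ys) → fs (SymV Φ) f ⊎ f ∈ᵒ ys
  mergedBody-free Φ P {ys} fr =
    let r , r∈Φ , fr′ = find (concatMap⁻ (ruleDisjunct P ys) (FreeIn-⋁⁻ _ fr))
    in Sum.map₁ (lose r∈Φ) (ruleDisjunct-free P r fr′)

module _ {q : PSym} where

  clause-preds : ∀ xs {k} (ys : Vec ℕ k) ts ψ → PredIn q (clause xs ys ts ψ) → PredIn q ψ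
  clause-preds [] ys ts ψ (andˡ pr) = contradiction (PredIn-⋀⁻ _ pr) (eqs-pred ys ts)
    where
    eqs-pred : ∀ {k} (ys : Vec ℕ k) ts → ¬ ListAny.Any (PredIn q) (eqs ys ts)
    eqs-pred [] [] ()
    eqs-pred (y ∷ ys) (t ∷ ts) (ListAny.there pr) = eqs-pred ys ts pr
  clause-preds [] ys ts ψ (andʳ pr) = pr
  clause-preds (x ∷ xs) ys ts ψ (ex pr) = clause-preds xs ys ts ψ pr

  ruleDisjunct-preds : ∀ P {ys} r → ListAny.Any (PredIn q) (ruleDisjunct P ys r) → PredIn q (body r)
  ruleDisjunct-preds P {ys} r with head r ≟S P
  ... | no _ = λ ()
  ... | yes refl = λ { (ListAny.here pr) → clause-preds (vars r) ys (args r) (body r) pr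
                     ; (ListAny.there ()) }

  mergedBody-preds : ∀ Φ P {ys} → PredIn q (mergedBody Φ P ys) → ps (SymV Φ) q
  mergedBody-preds Φ P {ys} pr =
    let r , r∈Φ , pr′ = find (concatMap⁻ (ruleDisjunct P ys) (PredIn-⋁⁻ _ pr))
    in inj₂ (lose r∈Φ (ruleDisjunct-preds P r pr′))

-- The canonical fresh names

mutual
  ∈T-≤ : ∀ {z} t → obj z ∈T t → z ≤ maxT t
  ∈T-≤ (app f ts) here = m≤m⊔n _ (maxTs ts)
  ∈T-≤ (app f ts) (under a) = m≤n⇒m≤o⊔n (proj₁ f) (Any-∈T-≤ ts a)

  Any-∈T-≤ : ∀ {z n} (ts : Vec Term n) → Any (obj z ∈T_) ts → z ≤ maxTs ts
  Any-∈T-≤ (t ∷ ts) (here m) = m≤n⇒m≤n⊔o (maxTs ts) (∈T-≤ t m)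
  Any-∈T-≤ (t ∷ ts) (there a) = m≤n⇒m≤o⊔n (maxT t) (Any-∈T-≤ ts a)

FreeIn-≤ : ∀ {z} φ → FreeIn (obj z) φ → z ≤ maxF φ
FreeIn-≤ (atom p ts) (atom a) = Any-∈T-≤ ts a
FreeIn-≤ (t ≐' u) (eqˡ m) = m≤n⇒m≤n⊔o _ (∈T-≤ t m)
FreeIn-≤ (t ≐' u) (eqʳ m) = m≤n⇒m≤o⊔n _ (∈T-≤ u m)
FreeIn-≤ (¬' φ) (neg fr) = FreeIn-≤ φ fr
FreeIn-≤ (φ ∧' ψ) (andˡ fr) = m≤n⇒m≤n⊔o _ (FreeIn-≤ φ fr)
FreeIn-≤ (φ ∧' ψ) (andʳ fr) = m≤n⇒m≤o⊔n _ (FreeIn-≤ ψ fr)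
FreeIn-≤ (φ ∨' ψ) (orˡ fr) = m≤n⇒m≤n⊔o _ (FreeIn-≤ φ fr)
FreeIn-≤ (φ ∨' ψ) (orʳ fr) = m≤n⇒m≤o⊔n _ (FreeIn-≤ ψ fr)
FreeIn-≤ (φ ⇒' ψ) (impˡ fr) = m≤n⇒m≤n⊔o _ (FreeIn-≤ φ fr)
FreeIn-≤ (φ ⇒' ψ) (impʳ fr) = m≤n⇒m≤o⊔n _ (FreeIn-≤ ψ fr)
FreeIn-≤ (φ ⇔' ψ) (iffˡ fr) = m≤n⇒m≤n⊔o _ (FreeIn-≤ φ fr)
FreeIn-≤ (φ ⇔' ψ) (iffʳ fr) = m≤n⇒m≤o⊔n _ (FreeIn-≤ ψ fr)
FreeIn-≤ (∀' x φ) (all _ fr) = m≤n⇒m≤o⊔n x (FreeIn-≤ φ fr)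
FreeIn-≤ (∃' x φ) (ex _ fr) = m≤n⇒m≤o⊔n x (FreeIn-≤ φ fr)

maxR-≤ : ∀ {r} Φ → r ∈ Φ → maxR r ≤ maxΦ Φ
maxR-≤ (r ∷ Φ) (ListAny.here refl) = m≤m⊔n (maxR r) _
maxR-≤ (r ∷ Φ) (ListAny.there r∈Φ) = m≤n⇒m≤o⊔n (maxR r) (maxR-≤ Φ r∈Φ)

freshVec-≥ : ∀ m k → All.All (m ≤_) (freshVec m k)
freshVec-≥ m zero = All.[]
freshVec-≥ m (suc k) = ≤-refl All.∷ All.map (≤-trans (n≤1+n m)) (freshVec-≥ (suc m) k)

freshYs-unique : ∀ Φ k → Unique (freshYs Φ k)
freshYs-unique Φ k = freshVec-unique (suc (maxΦ Φ)) k
  where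
  freshVec-unique : ∀ m k → Unique (freshVec m k)
  freshVec-unique m zero = []
  freshVec-unique m (suc k) = All.map <⇒≢ (freshVec-≥ (suc m) k) ∷ freshVec-unique (suc m) k

freshYs-fresh : ∀ Φ P → FreshFor Φ P (freshYs Φ (ar P))
freshYs-fresh Φ P r r∈Φ _ z z∈ys =
  (λ fr → above (m≤n⇒m≤o⊔n _ (FreeIn-≤ (body r) fr))) ,
  (λ a → above (m≤n⇒m≤n⊔o (maxF (body r)) (m≤n⇒m≤o⊔n _ (Any-∈T-≤ (args r) a)))) ,
  (λ z∈xs → above (m≤n⇒m≤n⊔o (maxF (body r)) (m≤n⇒m≤n⊔o (maxTs (args r)) (≤-foldr-⊔ (vars r) z∈xs))))
  where
  above : ¬ z ≤ maxR r
  above z≤r = <⇒≱ (All.lookup (freshVec-≥ _ (ar P)) z∈ys) (≤-trans z≤r (maxR-≤ Φ r∈Φ))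

-- Henkin models

module Expansion (Φ : List Rule) (I : Structure) where

  expand-defined : ∀ {R p} → Defined Φ p → expand Φ I R p ≡ R p
  expand-defined {p = p} d with defined? Φ p
  ... | yes _ = refl
  ... | no ¬d = contradiction d ¬d

  expand-rel : ∀ p as → expand Φ I (rel I) p as ⇔ rel I p as
  expand-rel p as with defined? Φ p
  ... | yes _ = ⇔.refl
  ... | no _ = ⇔.refl

  expand-mono : ∀ {R R′} → (∀ p → Defined Φ p → ∀ as → R p as → R′ p as) → expand Φ I R ⊆ᴿ expand Φ I R′
  expand-mono R⊆R′ p as with defined? Φ p
  ... | yes d = R⊆R′ p d as
  ... | no _ = id

  ⊑⇒⊆ : ∀ {R R′} → _⊑_ Φ I (expand Φ I R) (expand Φ I R′) → ∀ p → Defined Φ p → ∀ as → R p as → R′ p as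
  ⊑⇒⊆ R⊑R′ p d as = subst₂ (λ S S′ → S as → S′ as) (expand-defined d) (expand-defined d) (R⊑R′ p d as)

  Cop-mono : ∀ {J J′ K K′} → J ⊆ᴿ J′ → K′ ⊆ᴿ K → Cop Φ I J K ⊆ᴿ Cop Φ I J′ K′
  Cop-mono J⊆J′ K′⊆K = expand-mono λ p _ _ → SatC-mono (mergedBody Φ p (freshYs Φ (ar p))) J⊆J′ K′⊆K

module HenkinModel (em : ExcludedMiddle 0ℓ) {Φ : List Rule} {I : Structure} {H : HClass (D I)}
                   (model : I , H ⊨H Φ) where
  open IsHenkinModel model
  open Definability em henkin using (definable)
  open Expansion Φ I

  Î : Rels (D I)
  Î = expand Φ I (rel I)

  φ̂ : PSym → Formula
  φ̂ p = mergedBody Φ p (freshYs Φ (ar p))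

  Ĉ : Rels (D I)
  Ĉ p as = SatC (fun I [ freshYs Φ (ar p) ↦* as ]) Î Î (φ̂ p)

  Sat⇔SatC : ∀ {F} φ → Sat F (rel I) φ ⇔ SatC F Î Î φ
  Sat⇔SatC φ = ⇔.trans (⇔.sym (SatC-diag em φ)) (mk⇔ (SatC-mono φ rel⊆Î Î⊆rel) (SatC-mono φ Î⊆rel rel⊆Î))
    where
    rel⊆Î : rel I ⊆ᴿ Î
    rel⊆Î p as = expand-rel p as .from
    Î⊆rel : Î ⊆ᴿ rel I
    Î⊆rel p as = expand-rel p as .to

  Ĉ-point : HPoint Φ I H (expand Φ I Ĉ)
  Ĉ-point p d = subst (H (ar p)) (sym (expand-defined d))
                      (IsHenkinClass.extensional henkin definable-φ̂ λ _ → Sat⇔SatC (φ̂ p))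
    where
    definable-φ̂ = definable (φ̂ p) (mergedBody-preds Φ p) (freshYs Φ (ar p)) (freshYs-unique Φ (ar p))
                            (mergedBody-free Φ p)

  Ĉ-prefixed : _⊑_ Φ I (Cop Φ I (expand Φ I Ĉ) Î) (expand Φ I Ĉ)
  Ĉ-prefixed p _ = Cop-mono (expand-mono (⊑⇒⊆ prefix)) (λ _ _ → id) p

  mergedBody-fixpoint : ∀ P → Defined Φ P → ∀ as →
                        rel I P as ⇔ Sat (fun I [ freshYs Φ (ar P) ↦* as ]) (rel I) (φ̂ P)
  mergedBody-fixpoint P d as = mk⇔
    (Sat⇔SatC (φ̂ P) .from ∘ ⊑⇒⊆ (least Ĉ Ĉ-point Ĉ-prefixed) P d as)
    (⊑⇒⊆ prefix P d as ∘ Sat⇔SatC (φ̂ P) .to)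

-- The model carries a Henkin class for Sym(Φ) itself.
proposition5p5 : ExcludedMiddle 0ℓ →
    (Φ : List Rule) → IsDefinition Φ →
    (P : PSym) → Defined Φ P →
    (ys : Vec ℕ (ar P)) →
    (∀ r → r ∈ Φ → head r ≡ P → ∀ y → y ∈ᵥ ys →
       ¬ FreeIn (obj y) (body r) × ¬ Any (obj y ∈T_) (args r) × ¬ (y ∈ vars r)) →
    (V : Vocab) (I : Structure) (H : HClass (D I)) →
    IsHenkinClass V I H → SymV Φ ⊆V V →
    I , H ⊨H Φ →
    I ⊨ ∀* ys (atom P (map var ys) ⇔' mergedBody Φ P ys)
proposition5p5 em Φ _ P P-defined ys ys-fresh _ I H _ _ model =
  ∀*-intro ys _ λ as → P⇔φ as .to , P⇔φ as .from
  where
  open HenkinModel em model using (mergedBody-fixpoint)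
  ỹs = freshYs Φ (ar P)
  P⇔φ : ∀ as → let F = fun I [ ys ↦* as ] in
        rel I P (evalTs F (map var ys)) ⇔ Sat F (rel I) (mergedBody Φ P ys)
  P⇔φ as = ⇔.trans (mergedBody-fixpoint P P-defined cs)
                   (mergedBody-cong Φ P (freshYs-fresh Φ P) ys-fresh agree
                                    (evalTs-update*-self (fun I) cs (freshYs-unique Φ (ar P))))
    where
    cs = evalTs (fun I [ ys ↦* as ]) (map var ys)
    agree : Agree (Outside ỹs ys) (fun I [ ỹs ↦* cs ]) (fun I [ ys ↦* as ])
    agree f (f∉ỹs , f∉ys) v =
      trans (update*-∉ (fun I) ỹs cs f∉ỹs v) (sym (update*-∉ (fun I) ys as f∉ys v))
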